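{- Let $k\geq 0$ and $d\geq1$ be integers. A vector $\mathfrak{c}=(c_1,\ldots,c_d)\in\mathbb{N}^d$ is the clique vector of a $k$-connected threshold graph if and only if the vector $\mathfrak{b}=(b_1,\ldots,b_d)$ defined by \[ \sum_{i=1}^d b_i x^{i-1}=\sum_{i=1}^d c_i (x-1)^{i-1} \] has positive components and $b_1=b_2=\cdots=b_k=1$.
   Context: All graphs are finite and simple. For a graph $G$, $S(G)$ is obtained from $G$ by adding a new vertex adjacent to all vertices of $G$, and $D(G)$ by adding a new isolated vertex. A graph is threshold if it can be obtained from the null graph (no vertices) by a sequence of $S$- and $D$-operations. The clique vector of a graph $G$ is $(c_1,\ldots,c_d)$, where $c_i$ is the number of cliques of $G$ with $i$ vertices and $d$ is the largest cardinality of a clique. A graph is $k$-connected (for $k\ge1$) if it has at least $k$ vertices and removing any set of fewer than $k$ vertices leaves a connected graph; every graph is $0$-connected. For $k=0$ the condition $b_1=\cdots=b_k=1$ is vacuous. -}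

module Defs where

open import Data.Bool using (Bool; true; false; _∧_; _∨_; not; if_then_else_)
open import Data.Nat using (ℕ; zero; suc; _<_; _≤_; _⊔_; _≡ᵇ_)
open import Data.Fin using (Fin; zero; suc; toℕ; _≟_)
open import Data.Fin.Subset using (Subset; _∈_; _∉_; ∣_∣)
open import Data.Integer using (ℤ; +_; _+_; _-_)
open import Data.List using (List; []; _∷_; length; filterᵇ; map; foldr; allFin)
open import Data.Vec using (Vec; []; _∷_; _∷ʳ_; zipWith; lookup)
open import Data.Product using (Σ; _×_)
open import Function.Bundles using (_↔_; Inverse)
open import Relation.Nullary.Decidable using (⌊_⌋)
open import Relation.Binary.PropositionalEquality using (_≡_)

record Graph (n : ℕ) : Set where
  field
    adj    : Fin n → Fin n → Bool
    sym    : ∀ u v → adj u v ≡ adj v u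
    irrefl : ∀ u → adj u u ≡ false
open Graph public

nullGraph : Graph 0
nullGraph = record { adj = λ () ; sym = λ () ; irrefl = λ () }

addVertex : ∀ {n} → Bool → Graph n → Graph (suc n)
addVertex {n} b G = record { adj = a ; sym = s ; irrefl = i }
  where
  a : Fin (suc n) → Fin (suc n) → Bool
  a zero    zero    = false
  a zero    (suc v) = b
  a (suc u) zero    = b
  a (suc u) (suc v) = adj G u v
  s : ∀ u v → a u v ≡ a v u
  s zero    zero    = _≡_.refl
  s zero    (suc v) = _≡_.refl
  s (suc u) zero    = _≡_.refl
  s (suc u) (suc v) = sym G u v
  i : ∀ u → a u u ≡ false
  i zero    = _≡_.refl
  i (suc u) = irrefl G u

S : ∀ {n} → Graph n → Graph (suc n)
S = addVertex true

D : ∀ {n} → Graph n → Graph (suc n)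
D = addVertex false

data Op : Set where
  opS opD : Op

applyOp : ∀ {n} → Op → Graph n → Graph (suc n)
applyOp opS = S
applyOp opD = D

-- build (o ∷ w) = o applied to build w : the head of the list is the
-- LAST operation performed, starting from the null graph.
build : (w : List Op) → Graph (length w)
build []      = nullGraph
build (o ∷ w) = applyOp o (build w)

Iso : ∀ {n m} → Graph n → Graph m → Set
Iso {n} {m} G H =
  Σ (Fin n ↔ Fin m) λ σ →
    ∀ u v → adj G u v ≡ adj H (Inverse.to σ u) (Inverse.to σ v)

IsThreshold : ∀ {n} → Graph n → Set
IsThreshold G = Σ (List Op) λ w → Iso G (build w)

allSubsets : (n : ℕ) → List (Subset n)
allSubsets zero    = [] ∷ []
allSubsets (suc n) =
  foldr (λ s acc → (true ∷ s) ∷ (false ∷ s) ∷ acc) [] (allSubsets n)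

allᵇ : {A : Set} → (A → Bool) → List A → Bool
allᵇ p = foldr (λ x r → p x ∧ r) true

inᵇ : ∀ {n} → Fin n → Subset n → Bool
inᵇ i s = lookup s i

isClique : ∀ {n} → Graph n → Subset n → Bool
isClique {n} G s =
  allᵇ (λ u → allᵇ (λ v →
      not (inᵇ u s ∧ inᵇ v s ∧ not ⌊ u ≟ v ⌋) ∨ adj G u v)
    (allFin n)) (allFin n)

numCliques : ∀ {n} → Graph n → ℕ → ℕ
numCliques {n} G i =
  length (filterᵇ (λ s → isClique G s ∧ (∣ s ∣ ≡ᵇ i)) (allSubsets n))

cliqueNumber : ∀ {n} → Graph n → ℕ
cliqueNumber {n} G = foldr _⊔_ 0 (map ∣_∣ (filterᵇ (isClique G) (allSubsets n)))

-- c = (c_1,…,c_d) is the clique vector of G (Vec index i ↦ c_{i+1})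
IsCliqueVector : ∀ {n d} → Graph n → Vec ℕ d → Set
IsCliqueVector {d = d} G c =
  (d ≡ cliqueNumber G) × (∀ (i : Fin d) → lookup c i ≡ numCliques G (suc (toℕ i)))

data Reach {n} (G : Graph n) (X : Subset n) (u : Fin n) : Fin n → Set where
  here : Reach G X u u
  step : ∀ {w v} → Reach G X u w → adj G w v ≡ true → v ∉ X → Reach G X u v

ConnectedWithout : ∀ {n} → Graph n → Subset n → Set
ConnectedWithout {n} G X = ∀ (u v : Fin n) → u ∉ X → v ∉ X → Reach G X u v

KConnected : ∀ {n} → ℕ → Graph n → Set
KConnected {n} k G = (k ≤ n) × (∀ (X : Subset n) → ∣ X ∣ < k → ConnectedWithout G X)

-- Polynomials as coefficient vectors (index i ↦ coefficient of x^i)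

-- multiply by (x - 1):  (x-1)·a = x·a - a
mulXm1 : ∀ {n} → Vec ℤ n → Vec ℤ (suc n)
mulXm1 a = zipWith _-_ (+ 0 ∷ a) (a ∷ʳ + 0)

addConst : ∀ {n} → ℤ → Vec ℤ (suc n) → Vec ℤ (suc n)
addConst c (x ∷ xs) = (c + x) ∷ xs

-- coefficients of Σ_i c_i (x-1)^{i-1}  (Horner: c_1 + (x-1)(c_2 + (x-1)(…)))
substXm1 : ∀ {n} → Vec ℤ n → Vec ℤ n
substXm1 []       = []
substXm1 (c ∷ cs) = addConst c (mulXm1 (substXm1 cs))

bVec : ∀ {d} → Vec ℕ d → Vec ℤ d
bVec c = substXm1 (Data.Vec.map +_ c)

-- coefficient of x^j (0 beyond the length)
coeff : ∀ {d} → Vec ℤ d → ℕ → ℤ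
coeff []       _       = + 0
coeff (x ∷ xs) zero    = x
coeff (x ∷ xs) (suc j) = coeff xs j

-- Write C(x) = 1 + Σ cᵢ xⁱ for the clique polynomial of a graph, the 1 counting the empty
-- clique. A clique of S G either avoids the new vertex or is a clique of G plus that vertex,
-- so S multiplies C by 1 + x; D only adds the new vertex as a 1-clique, so it adds x. After
-- the substitution x ↦ x - 1 this says that the b-vector of S G is 1 followed by the b-vector
-- of G, while D adds 1 to b₁ (creating b₁ = 1 for the null graph). Hence the b-vectors of
-- threshold graphs are exactly the vectors with positive entries, b being realised by the
-- word D^(b₁-1) S D^(b₂-1) S ⋯, and b determines c because the substitution is invertible.
-- Finally S G is (k+1)-connected iff G is k-connected, while D G is 1-connected only when G
-- is null, so k-connectivity says that b starts with k ones.

module Submission where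

open import Defs hiding (sym)
open import Data.Bool using (Bool; true; false; _∧_; _∨_; not; T; T?)
open import Data.Bool.Properties using (∧-idem; ∧-zeroʳ; ∧-identityʳ; ⇔→≡; T-≡)
open import Data.Empty using (⊥-elim) renaming (⊥ to Empty)
open import Data.Fin using (Fin; zero; suc; toℕ; _≟_)
open import Data.Fin.Properties using (suc-injective; injective⇒≤)
open import Data.Fin.Subset using (Subset; ∣_∣; ⊥; _∉_) renaming (_∈_ to _∈ˢ_)
open import Data.Fin.Subset.Properties using (∣⊥∣≡0; Empty-unique; ∉⊥)
open import Data.List using (List; []; _∷_; _++_; length; map; foldr; filterᵇ; allFin)
  renaming (tabulate to tabulateᴸ; replicate to replicateᴸ)
open import Data.List.Properties
  using (∷-injectiveˡ; ∷-injectiveʳ; map-injective; length-++; length-map; map-++; map-∘; map-cong; map-tabulate;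
         filter-++; filter-≐)
open import Data.List.Membership.Propositional using (_∈_)
open import Data.List.Membership.Propositional.Properties using (∈-allFin; ∈-map⁺; ∈-filter⁺)
open import Data.List.Relation.Unary.All as All using (All; []; _∷_)
open import Data.List.Relation.Unary.AllPairs using ([]; _∷_)
open import Data.List.Relation.Unary.Any using (here; there)
open import Data.List.Relation.Unary.Unique.Propositional using (Unique)
open import Data.List.Relation.Unary.Unique.Propositional.Properties
  using (allFin⁺) renaming (map⁺ to map⁺-unique)
open import Data.List.Relation.Binary.BagAndSetEquality using (∼bag⇒↭)
open import Data.List.Membership.Propositional.Properties.WithK using (unique∧set⇒bag)
open import Data.List.Relation.Binary.Permutation.Propositional
  using (_↭_; ↭-refl; ↭-sym; ↭-trans; ↭-reflexive; prep; ↭⇒↭ₛ)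
open import Data.List.Relation.Binary.Permutation.Propositional.Properties
  using (↭-length; ↭-singleton-inv; map⁺; filter-↭; shift)
open import Data.List.Relation.Binary.Permutation.Setoid.Properties using (foldr-commMonoid)
open import Data.Nat using (ℕ; zero; suc; pred; _+_; _⊔_; _≤_; _<_; _≡ᵇ_; z≤n; s≤s)
open import Data.Nat.Properties
  using (≤-trans; n≤0⇒n≡0; +-comm; ⊔-assoc; ⊔-identityʳ; n≤1+n; m≥n⇒m⊔n≡m; ⊔-0-commutativeMonoid)
open import Data.Integer using (ℤ; +_; _-_; -_; +<+)
import Data.Integer as ℤ using (_+_; _<_)
import Data.Integer
import Data.Integer.Properties as ℤₚ
open import Data.Integer.Tactic.RingSolver using (solve-∀)
open import Data.Product using (Σ; _×_; _,_; proj₁)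
open import Data.Vec using (Vec; []; _∷_; _∷ʳ_; here; there; lookup; tabulate; zipWith; toList)
import Data.Vec as Vec
import Data.Vec.Properties as Vecₚ
open import Data.Vec.Properties
  using (lookup-replicate; toList-map; length-toList; []=⇒lookup; lookup⇒[]=; lookup∘tabulate; tabulate-cong;
         tabulate∘lookup)
open import Function using (_∘_; _⇔_; mk⇔; Equivalence; _↔_; Inverse; Injection)
open import Function.Construct.Symmetry using (↔-sym; ⇔-sym)
open import Function.Construct.Identity using (↔-id)
open import Function.Construct.Composition using (_⇔-∘_)
open import Function.Properties.Inverse using (↔⇒↣)
open import Algebra.Bundles using (CommutativeMonoid)
open import Relation.Binary.PropositionalEquality
open import Relation.Nullary using (¬_; yes; no)
open import Relation.Nullary.Decidable using (⌊_⌋)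

private
  variable
    A B : Set
    a b n : ℕ

countᵇ : (A → Bool) → List A → ℕ
countᵇ p xs = length (filterᵇ p xs)

filterᵇ-cong : {p q : A → Bool} → (∀ x → p x ≡ q x) → ∀ xs → filterᵇ p xs ≡ filterᵇ q xs
filterᵇ-cong {p = p} {q} p≗q =
  filter-≐ (T? ∘ p) (T? ∘ q) ((λ {x} → subst T (p≗q x)) , (λ {x} → subst T (sym (p≗q x))))

countᵇ-cong : {p q : A → Bool} → (∀ x → p x ≡ q x) → ∀ xs → countᵇ p xs ≡ countᵇ q xs
countᵇ-cong p≗q xs = cong length (filterᵇ-cong p≗q xs)

filterᵇ-none : {p : A → Bool} → (∀ x → p x ≡ false) → ∀ xs → filterᵇ p xs ≡ []
filterᵇ-none p≡false []       = refl
filterᵇ-none p≡false (x ∷ xs) rewrite p≡false x = filterᵇ-none p≡false xs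

filterᵇ-map : (p : B → Bool) (f : A → B) → ∀ xs → filterᵇ p (map f xs) ≡ map f (filterᵇ (p ∘ f) xs)
filterᵇ-map p f [] = refl
filterᵇ-map p f (x ∷ xs) with p (f x)
... | true  = cong (f x ∷_) (filterᵇ-map p f xs)
... | false = filterᵇ-map p f xs

countᵇ-map : (p : B → Bool) (f : A → B) → ∀ xs → countᵇ p (map f xs) ≡ countᵇ (p ∘ f) xs
countᵇ-map p f xs = trans (cong length (filterᵇ-map p f xs)) (length-map f (filterᵇ (p ∘ f) xs))

countᵇ-↭ : (p : A → Bool) {xs ys : List A} → xs ↭ ys → countᵇ p xs ≡ countᵇ p ys
countᵇ-↭ p xs↭ys = ↭-length (filter-↭ (T? ∘ p) xs↭ys)

enumerations-↭ : {xs ys : List A} → Unique xs → Unique ys → (∀ x → x ∈ xs) → (∀ x → x ∈ ys) → xs ↭ ys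
enumerations-↭ !xs !ys ∈xs ∈ys = ∼bag⇒↭ (unique∧set⇒bag !xs !ys (λ {x} → mk⇔ (λ _ → ∈ys x) (λ _ → ∈xs x)))

maxList : List ℕ → ℕ
maxList = foldr _⊔_ 0

maxList-++ : ∀ xs ys → maxList (xs ++ ys) ≡ maxList xs ⊔ maxList ys
maxList-++ []       ys = refl
maxList-++ (x ∷ xs) ys = trans (cong (x ⊔_) (maxList-++ xs ys)) (sym (⊔-assoc x (maxList xs) (maxList ys)))

maxList-↭ : {xs ys : List ℕ} → xs ↭ ys → maxList xs ≡ maxList ys
maxList-↭ xs↭ys = foldr-commMonoid ℕ-⊔.setoid ℕ-⊔.isCommutativeMonoid (↭⇒↭ₛ xs↭ys)
  where module ℕ-⊔ = CommutativeMonoid ⊔-0-commutativeMonoid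

maxList-map-suc : ∀ {x xs} → x ∈ xs → maxList (map suc xs) ≡ suc (maxList xs)
maxList-map-suc {xs = y ∷ []}     _ = cong suc (sym (⊔-identityʳ y))
maxList-map-suc {xs = y ∷ z ∷ zs} _ = cong (suc y ⊔_) (maxList-map-suc {xs = z ∷ zs} (here refl))

-- allSubsets (suc n) is definitionally extend (allSubsets n).
extend : List (Subset n) → List (Subset (suc n))
extend = foldr (λ s acc → (true ∷ s) ∷ (false ∷ s) ∷ acc) []

∈-extend⁺ : ∀ b {s : Subset n} {L} → s ∈ L → (b ∷ s) ∈ extend L
∈-extend⁺ true  (here refl) = here refl
∈-extend⁺ false (here refl) = there (here refl)
∈-extend⁺ b     (there s∈L) = there (there (∈-extend⁺ b s∈L))

∈-extend⁻ : ∀ {b} {s : Subset n} L → (b ∷ s) ∈ extend L → s ∈ L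
∈-extend⁻ (t ∷ L) (here refl)         = here refl
∈-extend⁻ (t ∷ L) (there (here refl)) = here refl
∈-extend⁻ (t ∷ L) (there (there m))   = there (∈-extend⁻ L m)

extend-unique : {L : List (Subset n)} → Unique L → Unique (extend L)
extend-unique []                          = []
extend-unique {L = s ∷ L} (s∉L ∷ !L) =
  ((λ ()) ∷ All.tabulate fresh) ∷ All.tabulate fresh ∷ extend-unique !L
  where
  fresh : ∀ {b y} → y ∈ extend L → b ∷ s ≢ y
  fresh {y = c ∷ t} y∈ refl = All.lookup s∉L (∈-extend⁻ L y∈) refl

extend-↭ : (L : List (Subset n)) → extend L ↭ map (true ∷_) L ++ map (false ∷_) L
extend-↭ []      = ↭-refl
extend-↭ (s ∷ L) = prep _ (↭-trans (prep _ (extend-↭ L))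
  (↭-sym (shift (false ∷ s) (map (true ∷_) L) (map (false ∷_) L))))

allSubsets-complete : ∀ n (s : Subset n) → s ∈ allSubsets n
allSubsets-complete zero    []      = here refl
allSubsets-complete (suc n) (b ∷ s) = ∈-extend⁺ b (allSubsets-complete n s)

allSubsets-unique : ∀ n → Unique (allSubsets n)
allSubsets-unique zero    = [] ∷ []
allSubsets-unique (suc n) = extend-unique (allSubsets-unique n)

filterᵇ-allSubsets-suc : (p : Subset (suc n) → Bool) →
  filterᵇ p (allSubsets (suc n)) ↭
    map (true ∷_) (filterᵇ (p ∘ (true ∷_)) (allSubsets n)) ++
    map (false ∷_) (filterᵇ (p ∘ (false ∷_)) (allSubsets n))
filterᵇ-allSubsets-suc {n} p = ↭-trans (filter-↭ (T? ∘ p) (extend-↭ L))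
  (↭-reflexive (trans (filter-++ (T? ∘ p) (map (true ∷_) L) (map (false ∷_) L))
    (cong₂ _++_ (filterᵇ-map p _ L) (filterᵇ-map p _ L))))
  where L = allSubsets n

allSubsets-ofSize0 : ∀ n → filterᵇ (λ s → ∣ s ∣ ≡ᵇ 0) (allSubsets n) ≡ ⊥ ∷ []
allSubsets-ofSize0 zero    = refl
allSubsets-ofSize0 (suc n) = ↭-singleton-inv (↭-trans (filterᵇ-allSubsets-suc _)
  (↭-reflexive (cong₂ (λ xs ys → map (true ∷_) xs ++ map (false ∷_) ys)
    (filterᵇ-none (λ _ → refl) (allSubsets n)) (allSubsets-ofSize0 n))))

∣s∣≡ᵇ0⇔s≡⊥ : (s : Subset n) → (∣ s ∣ ≡ᵇ 0) ≡ true ⇔ s ≡ ⊥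
∣s∣≡ᵇ0⇔s≡⊥ []          = mk⇔ (λ _ → refl) (λ _ → refl)
∣s∣≡ᵇ0⇔s≡⊥ (true ∷ s)  = mk⇔ (λ ()) (λ ())
∣s∣≡ᵇ0⇔s≡⊥ (false ∷ s) = mk⇔ (cong (false ∷_) ∘ to) (from ∘ Vecₚ.∷-injectiveʳ)
  where open Equivalence (∣s∣≡ᵇ0⇔s≡⊥ s)

IsClique : Graph n → Subset n → Set
IsClique {n} G s = ∀ (u v : Fin n) → lookup s u ≡ true → lookup s v ≡ true → u ≢ v → adj G u v ≡ true

allᵇ-sound : {p : A → Bool} (xs : List A) → allᵇ p xs ≡ true → All (λ x → p x ≡ true) xs
allᵇ-sound []           _ = []
allᵇ-sound {p = p} (x ∷ xs) h with p x in px
... | true = px ∷ allᵇ-sound xs h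

allᵇ-complete : {p : A → Bool} (xs : List A) → All (λ x → p x ≡ true) xs → allᵇ p xs ≡ true
allᵇ-complete []       []        = refl
allᵇ-complete (x ∷ xs) (px ∷ ps) rewrite px = allᵇ-complete xs ps

pairTest : Graph n → Subset n → Fin n → Fin n → Bool
pairTest G s u v = not (inᵇ u s ∧ inᵇ v s ∧ not ⌊ u ≟ v ⌋) ∨ adj G u v

pairTest⇔ : (G : Graph n) (s : Subset n) (u v : Fin n) →
  pairTest G s u v ≡ true ⇔ (lookup s u ≡ true → lookup s v ≡ true → u ≢ v → adj G u v ≡ true)
pairTest⇔ G s u v with lookup s u | lookup s v | u ≟ v
... | false | _     | _       = mk⇔ (λ _ ()) (λ _ → refl)
... | true  | false | _       = mk⇔ (λ _ _ ()) (λ _ → refl)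
... | true  | true  | yes u≡v = mk⇔ (λ _ _ _ u≢v → ⊥-elim (u≢v u≡v)) (λ _ → refl)
... | true  | true  | no u≢v  = mk⇔ (λ e _ _ _ → e) (λ h → h refl refl u≢v)

isClique⇔IsClique : (G : Graph n) (s : Subset n) → isClique G s ≡ true ⇔ IsClique G s
isClique⇔IsClique {n} G s = mk⇔
  (λ e u v → to (pairTest⇔ G s u v)
    (All.lookup (allᵇ-sound (allFin n) (All.lookup (allᵇ-sound (allFin n) e) (∈-allFin u))) (∈-allFin v)))
  (λ h → allᵇ-complete (allFin n) (All.universal
    (λ u → allᵇ-complete (allFin n) (All.universal (λ v → from (pairTest⇔ G s u v) (h u v)) _)) _))
  where open Equivalence

isClique-cong : (G : Graph a) (H : Graph b) (s : Subset a) (t : Subset b) →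
  IsClique G s ⇔ IsClique H t → isClique G s ≡ isClique H t
isClique-cong G H s t G⇔H = ⇔→≡ (⇔-sym (isClique⇔IsClique H t) ⇔-∘ (G⇔H ⇔-∘ isClique⇔IsClique G s))

lookup-⊥ : (v : Fin n) → lookup ⊥ v ≢ true
lookup-⊥ v v∈⊥ with () ← trans (sym (lookup-replicate v false)) v∈⊥

isClique-⊥ : (G : Graph n) → isClique G ⊥ ≡ true
isClique-⊥ G = Equivalence.from (isClique⇔IsClique G ⊥) (λ u _ u∈⊥ → ⊥-elim (lookup-⊥ u u∈⊥))

isClique∧size0 : (G : Graph n) (s : Subset n) → isClique G s ∧ (∣ s ∣ ≡ᵇ 0) ≡ (∣ s ∣ ≡ᵇ 0)
isClique∧size0 G s with ∣ s ∣ ≡ᵇ 0 in size0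
... | false = ∧-zeroʳ _
... | true  = trans (∧-identityʳ _)
  (subst (λ t → isClique G t ≡ true) (sym (Equivalence.to (∣s∣≡ᵇ0⇔s≡⊥ s) size0)) (isClique-⊥ G))

IsClique-restrict : ∀ {x c} {G : Graph n} {s} → IsClique (addVertex x G) (c ∷ s) → IsClique G s
IsClique-restrict h u v su sv u≢v = h (suc u) (suc v) su sv (u≢v ∘ suc-injective)

IsClique-S-true : {G : Graph n} {s : Subset n} → IsClique (S G) (true ∷ s) ⇔ IsClique G s
IsClique-S-true {G = G} {s} = mk⇔ IsClique-restrict extend-clique
  where
  extend-clique : IsClique G s → IsClique (S G) (true ∷ s)
  extend-clique h zero    zero    _  _  u≢v = ⊥-elim (u≢v refl)
  extend-clique h zero    (suc v) _  _  _   = refl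
  extend-clique h (suc u) zero    _  _  _   = refl
  extend-clique h (suc u) (suc v) su sv u≢v = h u v su sv (u≢v ∘ cong suc)

IsClique-addVertex-false : ∀ {x} {G : Graph n} {s : Subset n} → IsClique (addVertex x G) (false ∷ s) ⇔ IsClique G s
IsClique-addVertex-false {x = x} {G} {s} = mk⇔ IsClique-restrict extend-clique
  where
  extend-clique : IsClique G s → IsClique (addVertex x G) (false ∷ s)
  extend-clique h (suc u) (suc v) su sv u≢v = h u v su sv (u≢v ∘ cong suc)

IsClique-D-true : {G : Graph n} {s : Subset n} → IsClique (D G) (true ∷ s) ⇔ s ≡ ⊥
IsClique-D-true {G = G} = mk⇔
  (λ h → Empty-unique (λ (v , v∈s) → false≢true (h zero (suc v) refl ([]=⇒lookup v∈s) (λ ()))))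
  (λ { refl → singleton })
  where
  false≢true : false ≢ true
  false≢true ()
  singleton : IsClique (D G) (true ∷ ⊥)
  singleton zero    zero    _  _  u≢v = ⊥-elim (u≢v refl)
  singleton zero    (suc v) _  sv _   = ⊥-elim (lookup-⊥ v sv)
  singleton (suc u) _       su _  _   = ⊥-elim (lookup-⊥ u su)

isClique-S : (G : Graph n) (b : Bool) (s : Subset n) → isClique (S G) (b ∷ s) ≡ isClique G s
isClique-S G true  s = isClique-cong (S G) G (true ∷ s) s IsClique-S-true
isClique-S G false s = isClique-cong (S G) G (false ∷ s) s IsClique-addVertex-false

isClique-D-false : (G : Graph n) (s : Subset n) → isClique (D G) (false ∷ s) ≡ isClique G s
isClique-D-false G s = isClique-cong (D G) G (false ∷ s) s IsClique-addVertex-false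

isClique-D-true : (G : Graph n) (s : Subset n) → isClique (D G) (true ∷ s) ≡ (∣ s ∣ ≡ᵇ 0)
isClique-D-true G s = ⇔→≡ (⇔-sym (∣s∣≡ᵇ0⇔s≡⊥ s) ⇔-∘ (IsClique-D-true ⇔-∘ isClique⇔IsClique (D G) (true ∷ s)))

numCliques-zero : (G : Graph n) → numCliques G 0 ≡ 1
numCliques-zero {n} G =
  trans (countᵇ-cong (isClique∧size0 G) (allSubsets n)) (cong length (allSubsets-ofSize0 n))

numCliques-split : (H : Graph (suc n)) (i : ℕ) →
  numCliques H i ≡ countᵇ (λ s → isClique H (true ∷ s) ∧ (suc ∣ s ∣ ≡ᵇ i)) (allSubsets n)
                 + countᵇ (λ s → isClique H (false ∷ s) ∧ (∣ s ∣ ≡ᵇ i)) (allSubsets n)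
numCliques-split {n} H i = trans (↭-length (filterᵇ-allSubsets-suc {n} (λ s → isClique H s ∧ (∣ s ∣ ≡ᵇ i))))
  (trans (length-++ (map (true ∷_) Ft)) (cong₂ _+_ (length-map (true ∷_) Ft) (length-map (false ∷_) Ff)))
  where
  Ft Ff : List (Subset n)
  Ft = filterᵇ (λ s → isClique H (true ∷ s) ∧ (suc ∣ s ∣ ≡ᵇ i)) (allSubsets n)
  Ff = filterᵇ (λ s → isClique H (false ∷ s) ∧ (∣ s ∣ ≡ᵇ i)) (allSubsets n)

numCliques-S-suc : (G : Graph n) (i : ℕ) → numCliques (S G) (suc i) ≡ numCliques G i + numCliques G (suc i)
numCliques-S-suc {n} G i = trans (numCliques-split (S G) (suc i)) (cong₂ _+_
  (countᵇ-cong (λ s → cong (_∧ (∣ s ∣ ≡ᵇ i)) (isClique-S G true s)) (allSubsets n))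
  (countᵇ-cong (λ s → cong (_∧ (∣ s ∣ ≡ᵇ suc i)) (isClique-S G false s)) (allSubsets n)))

numCliques-D-one : (G : Graph n) → numCliques (D G) 1 ≡ suc (numCliques G 1)
numCliques-D-one {n} G = trans (numCliques-split (D G) 1) (cong₂ _+_
  (trans (countᵇ-cong (λ s → trans (cong (_∧ (∣ s ∣ ≡ᵇ 0)) (isClique-D-true G s)) (∧-idem _)) (allSubsets n))
         (cong length (allSubsets-ofSize0 n)))
  (countᵇ-cong (λ s → cong (_∧ (∣ s ∣ ≡ᵇ 1)) (isClique-D-false G s)) (allSubsets n)))

numCliques-D-suc-suc : (G : Graph n) (i : ℕ) → numCliques (D G) (suc (suc i)) ≡ numCliques G (suc (suc i))
numCliques-D-suc-suc {n} G i = trans (numCliques-split (D G) (suc (suc i))) (cong₂ _+_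
  (cong length (filterᵇ-none (λ s → trans (cong (_∧ (∣ s ∣ ≡ᵇ suc i)) (isClique-D-true G s)) (size0∧sizeSuc ∣ s ∣))
    (allSubsets n)))
  (countᵇ-cong (λ s → cong (_∧ (∣ s ∣ ≡ᵇ suc (suc i))) (isClique-D-false G s)) (allSubsets n)))
  where
  size0∧sizeSuc : ∀ m → (m ≡ᵇ 0) ∧ (m ≡ᵇ suc i) ≡ false
  size0∧sizeSuc zero    = refl
  size0∧sizeSuc (suc m) = refl

cliqueNumber-split : (H : Graph (suc n)) →
  cliqueNumber H ≡ maxList (map (suc ∘ ∣_∣) (filterᵇ (isClique H ∘ (true ∷_)) (allSubsets n)))
                 ⊔ maxList (map ∣_∣ (filterᵇ (isClique H ∘ (false ∷_)) (allSubsets n)))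
cliqueNumber-split {n} H = trans (maxList-↭ (map⁺ ∣_∣ (filterᵇ-allSubsets-suc {n} (isClique H))))
  (trans (cong maxList (map-++ ∣_∣ (map (true ∷_) Ft) (map (false ∷_) Ff)))
  (trans (maxList-++ (map ∣_∣ (map (true ∷_) Ft)) (map ∣_∣ (map (false ∷_) Ff)))
  (cong₂ _⊔_ (cong maxList (sym (map-∘ Ft))) (cong maxList (sym (map-∘ Ff))))))
  where
  Ft Ff : List (Subset n)
  Ft = filterᵇ (isClique H ∘ (true ∷_)) (allSubsets n)
  Ff = filterᵇ (isClique H ∘ (false ∷_)) (allSubsets n)

cliqueNumber-S : (G : Graph n) → cliqueNumber (S G) ≡ suc (cliqueNumber G)
cliqueNumber-S {n} G = begin
  cliqueNumber (S G)
    ≡⟨ cliqueNumber-split (S G) ⟩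
  maxList (map (suc ∘ ∣_∣) (filterᵇ (isClique (S G) ∘ (true ∷_)) L))
    ⊔ maxList (map ∣_∣ (filterᵇ (isClique (S G) ∘ (false ∷_)) L))
    ≡⟨ cong₂ (λ Ft Ff → maxList (map (suc ∘ ∣_∣) Ft) ⊔ maxList (map ∣_∣ Ff))
         (filterᵇ-cong (isClique-S G true) L) (filterᵇ-cong (isClique-S G false) L) ⟩
  maxList (map (suc ∘ ∣_∣) cliques) ⊔ maxList sizes
    ≡⟨ cong (λ m → maxList m ⊔ maxList sizes) (map-∘ {g = suc} {f = ∣_∣} cliques) ⟩
  maxList (map suc sizes) ⊔ maxList sizes
    ≡⟨ cong (_⊔ maxList sizes) (maxList-map-suc {∣ ⊥ {n} ∣} ∣⊥∣∈sizes) ⟩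
  suc (maxList sizes) ⊔ maxList sizes
    ≡⟨ m≥n⇒m⊔n≡m (n≤1+n (maxList sizes)) ⟩
  suc (cliqueNumber G) ∎
  where
  open ≡-Reasoning
  L cliques : List (Subset n)
  L = allSubsets n
  cliques = filterᵇ (isClique G) L
  sizes : List ℕ
  sizes = map ∣_∣ cliques
  ∣⊥∣∈sizes : ∣ ⊥ {n} ∣ ∈ sizes
  ∣⊥∣∈sizes = ∈-map⁺ ∣_∣ (∈-filter⁺ (T? ∘ isClique G) (allSubsets-complete n ⊥)
    (Equivalence.from T-≡ (isClique-⊥ G)))

cliqueNumber-D : (G : Graph n) → cliqueNumber (D G) ≡ 1 ⊔ cliqueNumber G
cliqueNumber-D {n} G = begin
  cliqueNumber (D G)
    ≡⟨ cliqueNumber-split (D G) ⟩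
  maxList (map (suc ∘ ∣_∣) (filterᵇ (isClique (D G) ∘ (true ∷_)) L))
    ⊔ maxList (map ∣_∣ (filterᵇ (isClique (D G) ∘ (false ∷_)) L))
    ≡⟨ cong₂ (λ Ft Ff → maxList (map (suc ∘ ∣_∣) Ft) ⊔ maxList (map ∣_∣ Ff))
         (trans (filterᵇ-cong (isClique-D-true G) L) (allSubsets-ofSize0 n))
         (filterᵇ-cong (isClique-D-false G) L) ⟩
  suc ∣ ⊥ {n} ∣ ⊔ cliqueNumber G
    ≡⟨ cong (λ m → suc m ⊔ cliqueNumber G) (∣⊥∣≡0 n) ⟩
  1 ⊔ cliqueNumber G ∎
  where
  open ≡-Reasoning
  L : List (Subset n)
  L = allSubsets n

-- Invariance under isomorphism

countᵇ-lookup-∷ : (c : Bool) (s : Subset n) →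
  countᵇ (lookup (c ∷ s)) (tabulateᴸ suc) ≡ countᵇ (lookup s) (allFin n)
countᵇ-lookup-∷ {n} c s = trans (cong (countᵇ (lookup (c ∷ s))) (sym (map-tabulate (λ x → x) suc)))
  (countᵇ-map (lookup (c ∷ s)) suc (allFin n))

∣s∣≡countᵇ : (s : Subset n) → ∣ s ∣ ≡ countᵇ (lookup s) (allFin n)
∣s∣≡countᵇ []          = refl
∣s∣≡countᵇ (true ∷ s)  = cong suc (trans (∣s∣≡countᵇ s) (sym (countᵇ-lookup-∷ true s)))
∣s∣≡countᵇ (false ∷ s) = trans (∣s∣≡countᵇ s) (sym (countᵇ-lookup-∷ false s))

image : Fin a ↔ Fin b → Subset a → Subset b
image σ s = tabulate (lookup s ∘ Inverse.from σ)

module _ (σ : Fin a ↔ Fin b) where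
  open Inverse σ

  lookup-image : ∀ s j → lookup (image σ s) j ≡ lookup s (from j)
  lookup-image s j = lookup∘tabulate (lookup s ∘ from) j

  ∈-image⁺ : ∀ {s j} → from j ∈ˢ s → j ∈ˢ image σ s
  ∈-image⁺ {s} {j} j∈s = lookup⇒[]= j (image σ s) (trans (lookup-image s j) ([]=⇒lookup j∈s))

  ∈-image⁻ : ∀ {s j} → j ∈ˢ image σ s → from j ∈ˢ s
  ∈-image⁻ {s} {j} j∈s = lookup⇒[]= (from j) s (trans (sym (lookup-image s j)) ([]=⇒lookup j∈s))

  image-↔-sym : ∀ t → image σ (image (↔-sym σ) t) ≡ t
  image-↔-sym t = trans
    (tabulate-cong (λ j → trans (lookup∘tabulate (lookup t ∘ to) (from j)) (cong (lookup t) (strictlyInverseˡ j))))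
    (tabulate∘lookup t)

  ∣image∣ : ∀ s → ∣ image σ s ∣ ≡ ∣ s ∣
  ∣image∣ s = begin
    ∣ image σ s ∣                           ≡⟨ ∣s∣≡countᵇ (image σ s) ⟩
    countᵇ (lookup (image σ s)) (allFin b)  ≡⟨ countᵇ-cong (lookup-image s) (allFin b) ⟩
    countᵇ (lookup s ∘ from) (allFin b)     ≡⟨ countᵇ-↭ (lookup s ∘ from) allFin-↭ ⟩
    countᵇ (lookup s ∘ from) (map to (allFin a)) ≡⟨ countᵇ-map (lookup s ∘ from) to (allFin a) ⟩
    countᵇ (lookup s ∘ from ∘ to) (allFin a) ≡⟨ countᵇ-cong (cong (lookup s) ∘ strictlyInverseʳ) (allFin a) ⟩
    countᵇ (lookup s) (allFin a)            ≡⟨ sym (∣s∣≡countᵇ s) ⟩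
    ∣ s ∣                                   ∎
    where
    open ≡-Reasoning
    allFin-↭ : allFin b ↭ map to (allFin a)
    allFin-↭ = enumerations-↭ (allFin⁺ b) (map⁺-unique (Injection.injective (↔⇒↣ σ)) (allFin⁺ a)) ∈-allFin
      (λ j → subst (_∈ map to (allFin a)) (strictlyInverseˡ j) (∈-map⁺ to (∈-allFin (from j))))

image-injective : (σ : Fin a ↔ Fin b) {s s' : Subset a} → image σ s ≡ image σ s' → s ≡ s'
image-injective σ {s} {s'} e =
  trans (sym (image-↔-sym (↔-sym σ) s)) (trans (cong (image (↔-sym σ)) e) (image-↔-sym (↔-sym σ) s'))

allSubsets-↭-image : (σ : Fin a ↔ Fin b) → allSubsets b ↭ map (image σ) (allSubsets a)
allSubsets-↭-image {a} {b} σ = enumerations-↭ (allSubsets-unique b)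
  (map⁺-unique (image-injective σ) (allSubsets-unique a)) (allSubsets-complete b)
  (λ t → subst (_∈ map (image σ) (allSubsets a)) (image-↔-sym σ t)
    (∈-map⁺ (image σ) (allSubsets-complete a (image (↔-sym σ) t))))

filterᵇ-allSubsets-image : (σ : Fin a ↔ Fin b) (p : Subset b → Bool) →
  filterᵇ p (allSubsets b) ↭ map (image σ) (filterᵇ (p ∘ image σ) (allSubsets a))
filterᵇ-allSubsets-image {a} σ p = ↭-trans (filter-↭ (T? ∘ p) (allSubsets-↭-image σ))
  (↭-reflexive (filterᵇ-map p (image σ) (allSubsets a)))

module _ {G : Graph a} {H : Graph b} (iso : Iso G H) where
  open Σ iso renaming (proj₁ to σ; proj₂ to adj-to)
  open Inverse σ

  lookup-image-to : ∀ s u → lookup (image σ s) (to u) ≡ lookup s u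
  lookup-image-to s u = trans (lookup-image σ s (to u)) (cong (lookup s) (strictlyInverseʳ u))

  IsClique-image : ∀ {s} → IsClique H (image σ s) ⇔ IsClique G s
  IsClique-image {s} = mk⇔
    (λ h u v su sv u≢v → trans (adj-to u v) (h (to u) (to v)
      (trans (lookup-image-to s u) su) (trans (lookup-image-to s v) sv) (u≢v ∘ to-injective)))
    (λ h u v su sv u≢v → trans (adj-from u v) (h (from u) (from v)
      (trans (sym (lookup-image σ s u)) su) (trans (sym (lookup-image σ s v)) sv) (u≢v ∘ from-injective)))
    where
    to-injective : ∀ {x y} → to x ≡ to y → x ≡ y
    to-injective = Injection.injective (↔⇒↣ σ)
    from-injective : ∀ {x y} → from x ≡ from y → x ≡ y
    from-injective = Injection.injective (↔⇒↣ (↔-sym σ))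
    adj-from : ∀ u v → adj H u v ≡ adj G (from u) (from v)
    adj-from u v = sym (trans (adj-to (from u) (from v)) (cong₂ (adj H) (strictlyInverseˡ u) (strictlyInverseˡ v)))

  isClique-image : ∀ s → isClique H (image σ s) ≡ isClique G s
  isClique-image s = isClique-cong H G (image σ s) s (IsClique-image {s})

  numCliques-iso : ∀ i → numCliques G i ≡ numCliques H i
  numCliques-iso i = sym (begin
    numCliques H i                  ≡⟨ ↭-length (filterᵇ-allSubsets-image σ p) ⟩
    length (map (image σ) cliques)  ≡⟨ length-map (image σ) cliques ⟩
    countᵇ (p ∘ image σ) (allSubsets a) ≡⟨ countᵇ-cong p∘image≗ (allSubsets a) ⟩
    numCliques G i                  ∎)
    where
    open ≡-Reasoning
    p : Subset b → Bool
    p t = isClique H t ∧ (∣ t ∣ ≡ᵇ i)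
    cliques : List (Subset a)
    cliques = filterᵇ (p ∘ image σ) (allSubsets a)
    p∘image≗ : ∀ s → p (image σ s) ≡ isClique G s ∧ (∣ s ∣ ≡ᵇ i)
    p∘image≗ s = cong₂ _∧_ (isClique-image s) (cong (_≡ᵇ i) (∣image∣ σ s))

  cliqueNumber-iso : cliqueNumber G ≡ cliqueNumber H
  cliqueNumber-iso = sym (begin
    cliqueNumber H                           ≡⟨ maxList-↭ (map⁺ ∣_∣ (filterᵇ-allSubsets-image σ (isClique H))) ⟩
    maxList (map ∣_∣ (map (image σ) cliques)) ≡⟨ cong maxList (sym (map-∘ cliques)) ⟩
    maxList (map (∣_∣ ∘ image σ) cliques)     ≡⟨ cong maxList (map-cong (∣image∣ σ) cliques) ⟩
    maxList (map ∣_∣ cliques)                 ≡⟨ cong (maxList ∘ map ∣_∣) (filterᵇ-cong isClique-image (allSubsets a)) ⟩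
    cliqueNumber G                            ∎)
    where
    open ≡-Reasoning
    cliques : List (Subset a)
    cliques = filterᵇ (isClique H ∘ image σ) (allSubsets a)

  IsCliqueVector-iso : ∀ {d} {c : Vec ℕ d} → IsCliqueVector G c → IsCliqueVector H c
  IsCliqueVector-iso (d≡ω , counts) = trans d≡ω cliqueNumber-iso , λ i → trans (counts i) (numCliques-iso _)

  Reach-image : ∀ X {u v} → Reach G (image (↔-sym σ) X) u v → Reach H X (to u) (to v)
  Reach-image X here               = here
  Reach-image X (step {w} {v} r e v∉) =
    step (Reach-image X r) (trans (sym (adj-to w v)) e) (v∉ ∘ ∈-image⁺ (↔-sym σ))

  KConnected-iso : ∀ {k} → KConnected k G → KConnected k H
  KConnected-iso {k} (k≤a , connected) = ≤-trans k≤a (injective⇒≤ (Injection.injective (↔⇒↣ σ))) ,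
    λ X ∣X∣<k u v u∉X v∉X → subst₂ (Reach H X) (strictlyInverseˡ u) (strictlyInverseˡ v)
      (Reach-image X (connected (image (↔-sym σ) X) (subst (_< k) (sym (∣image∣ (↔-sym σ) X)) ∣X∣<k)
        (from u) (from v) (avoids u∉X) (avoids v∉X)))
    where
    avoids : ∀ {X u} → u ∉ X → from u ∉ image (↔-sym σ) X
    avoids {X} {u} u∉X = u∉X ∘ subst (_∈ˢ X) (strictlyInverseˡ u) ∘ ∈-image⁻ (↔-sym σ)

-- Connectivity of S G and D G

Reach-trans : {G : Graph n} {X : Subset n} {u v w : Fin n} → Reach G X u v → Reach G X v w → Reach G X u w
Reach-trans r here          = r
Reach-trans r (step s e w∉) = step (Reach-trans r s) e w∉

Reach-addVertex⁺ : ∀ {x c} {G : Graph n} {X u v} → Reach G X u v → Reach (addVertex x G) (c ∷ X) (suc u) (suc v)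
Reach-addVertex⁺ here          = here
Reach-addVertex⁺ (step r e v∉) = step (Reach-addVertex⁺ r) e (λ { (there v∈) → v∉ v∈ })

Reach-addVertex⁻ : ∀ {x} {G : Graph n} {X u y} →
  Reach (addVertex x G) (true ∷ X) (suc u) y → ∀ v → y ≡ suc v → Reach G X u v
Reach-addVertex⁻ here                  v refl = here
Reach-addVertex⁻ (step {zero} r _ _)   v refl = ⊥-elim (avoidsNew r)
  where
  avoidsNew : ∀ {x} {G : Graph n} {X u} → Reach (addVertex x G) (true ∷ X) (suc u) zero → Empty
  avoidsNew (step _ _ zero∉) = zero∉ here
Reach-addVertex⁻ (step {suc w} r e v∉) v refl = step (Reach-addVertex⁻ r w refl) e (v∉ ∘ there)

¬KConnected-null : ∀ {k} → ¬ KConnected (suc k) nullGraph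
¬KConnected-null (() , _)

KConnected-S⁻ : ∀ {k} {G : Graph n} → KConnected (suc k) (S G) → KConnected k G
KConnected-S⁻ (s≤s k≤n , connected) = k≤n , λ X ∣X∣<k u v u∉X v∉X →
  Reach-addVertex⁻ (connected (true ∷ X) (s≤s ∣X∣<k) (suc u) (suc v) (u∉X ∘ drop-there) (v∉X ∘ drop-there)) v refl
  where
  drop-there : ∀ {X : Subset n} {u} → suc u ∈ˢ (true ∷ X) → u ∈ˢ X
  drop-there (there u∈) = u∈

KConnected-S⁺ : ∀ {k} {G : Graph n} → KConnected k G → KConnected (suc k) (S G)
KConnected-S⁺ {n} {k} {G} (k≤n , connected) = s≤s k≤n , connectedS
  where
  viaNew : ∀ {X : Subset n} u v → v ∉ (false ∷ X) → Reach (S G) (false ∷ X) u v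
  viaNew {X} u v v∉ = Reach-trans (toNew u) (fromNew v v∉)
    where
    toNew : ∀ u → Reach (S G) (false ∷ X) u zero
    toNew zero    = here
    toNew (suc u) = step here refl (λ ())
    fromNew : ∀ v → v ∉ (false ∷ X) → Reach (S G) (false ∷ X) zero v
    fromNew zero    _  = here
    fromNew (suc v) v∉ = step here refl v∉
  connectedS : ∀ (X : Subset (suc n)) → ∣ X ∣ < suc k → ConnectedWithout (S G) X
  connectedS (false ∷ X) _           u       v       _   v∉ = viaNew u v v∉
  connectedS (true ∷ X)  _           zero    _       u∉  _  = ⊥-elim (u∉ here)
  connectedS (true ∷ X)  _           (suc u) zero    _   v∉ = ⊥-elim (v∉ here)
  connectedS (true ∷ X)  (s≤s ∣X∣<k) (suc u) (suc v) u∉  v∉ =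
    Reach-addVertex⁺ (connected X ∣X∣<k u v (u∉ ∘ there) (v∉ ∘ there))

Reach-D-new : {G : Graph n} {X : Subset (suc n)} {y : Fin (suc n)} → Reach (D G) X zero y → y ≡ zero
Reach-D-new here = refl
Reach-D-new {G = G} (step {v = y} r e _) rewrite Reach-D-new r = ⊥-elim (noEdge y e)
  where
  noEdge : ∀ y → adj (D G) zero y ≢ true
  noEdge zero    ()
  noEdge (suc y) ()

KConnected-D⁻ : ∀ {k} {G : Graph n} → KConnected (suc k) (D G) → n ≡ 0 × k ≡ 0
KConnected-D⁻ {zero}  (s≤s k≤0 , _) = refl , n≤0⇒n≡0 k≤0
KConnected-D⁻ {suc n} (_ , connected)
  with () ← Reach-D-new (connected ⊥ (subst (_< _) (sym (∣⊥∣≡0 (suc (suc n)))) (s≤s z≤n))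
                                   zero (suc zero) ∉⊥ ∉⊥)

KConnected-D-null : (G : Graph 0) → KConnected 1 (D G)
KConnected-D-null G = s≤s z≤n , λ { X _ zero zero _ _ → here }

nth : List ℕ → ℕ → ℕ
nth []       _       = 0
nth (x ∷ xs) zero    = x
nth (x ∷ xs) (suc j) = nth xs j

-- mulOnePlusX a l lists the coefficients of x, x², … in (1 + x)(a + x·l).
mulOnePlusX : ℕ → List ℕ → List ℕ
mulOnePlusX a []       = a ∷ []
mulOnePlusX a (x ∷ xs) = (x + a) ∷ mulOnePlusX x xs

incHead : List ℕ → List ℕ
incHead []       = 1 ∷ []
incHead (x ∷ xs) = suc x ∷ xs

cliqueList : List Op → List ℕ
cliqueList []        = []
cliqueList (opS ∷ w) = mulOnePlusX 1 (cliqueList w)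
cliqueList (opD ∷ w) = incHead (cliqueList w)

bList : List Op → List ℕ
bList []        = []
bList (opS ∷ w) = 1 ∷ bList w
bList (opD ∷ w) = incHead (bList w)

nth-mulOnePlusX : ∀ a l i → nth (mulOnePlusX a l) i ≡ nth l i + nth (a ∷ l) i
nth-mulOnePlusX a []       zero    = refl
nth-mulOnePlusX a []       (suc i) = refl
nth-mulOnePlusX a (x ∷ xs) zero    = refl
nth-mulOnePlusX a (x ∷ xs) (suc i) = nth-mulOnePlusX x xs i

nth-incHead-zero : ∀ l → nth (incHead l) 0 ≡ suc (nth l 0)
nth-incHead-zero []      = refl
nth-incHead-zero (_ ∷ _) = refl

nth-incHead-suc : ∀ l i → nth (incHead l) (suc i) ≡ nth l (suc i)
nth-incHead-suc []      i = refl
nth-incHead-suc (_ ∷ _) i = refl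

length-mulOnePlusX : ∀ a l → length (mulOnePlusX a l) ≡ suc (length l)
length-mulOnePlusX a []       = refl
length-mulOnePlusX a (x ∷ xs) = cong suc (length-mulOnePlusX x xs)

length-incHead : ∀ l → length (incHead l) ≡ 1 ⊔ length l
length-incHead []      = refl
length-incHead (_ ∷ _) = refl

numCliques-build : ∀ w i → numCliques (build w) i ≡ nth (1 ∷ cliqueList w) i
numCliques-build w         zero          = numCliques-zero (build w)
numCliques-build []        (suc i)       = refl
numCliques-build (opS ∷ w) (suc i)       = begin
  numCliques (S (build w)) (suc i)                      ≡⟨ numCliques-S-suc (build w) i ⟩
  numCliques (build w) i + numCliques (build w) (suc i) ≡⟨ cong₂ _+_ (numCliques-build w i) (numCliques-build w (suc i)) ⟩
  nth (1 ∷ cliqueList w) i + nth (cliqueList w) i       ≡⟨ +-comm _ (nth (cliqueList w) i) ⟩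
  nth (cliqueList w) i + nth (1 ∷ cliqueList w) i       ≡⟨ sym (nth-mulOnePlusX 1 (cliqueList w) i) ⟩
  nth (mulOnePlusX 1 (cliqueList w)) i                  ∎
  where open ≡-Reasoning
numCliques-build (opD ∷ w) (suc zero)    = trans (numCliques-D-one (build w))
  (trans (cong suc (numCliques-build w 1)) (sym (nth-incHead-zero (cliqueList w))))
numCliques-build (opD ∷ w) (suc (suc i)) = trans (numCliques-D-suc-suc (build w) i)
  (trans (numCliques-build w (suc (suc i))) (sym (nth-incHead-suc (cliqueList w) i)))

cliqueNumber-build : ∀ w → cliqueNumber (build w) ≡ length (cliqueList w)
cliqueNumber-build []        = refl
cliqueNumber-build (opS ∷ w) = trans (cliqueNumber-S (build w))
  (trans (cong suc (cliqueNumber-build w)) (sym (length-mulOnePlusX 1 (cliqueList w))))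
cliqueNumber-build (opD ∷ w) = trans (cliqueNumber-D (build w))
  (trans (cong (1 ⊔_) (cliqueNumber-build w)) (sym (length-incHead (cliqueList w))))

bList-positive : ∀ w → All (0 <_) (bList w)
bList-positive []        = []
bList-positive (opS ∷ w) = s≤s z≤n ∷ bList-positive w
bList-positive (opD ∷ w) = incHead-positive (bList-positive w)
  where
  incHead-positive : ∀ {l} → All (0 <_) l → All (0 <_) (incHead l)
  incHead-positive []       = s≤s z≤n ∷ []
  incHead-positive (_ ∷ ps) = s≤s z≤n ∷ ps

StartsWithOnes : ℕ → List ℕ → Set
StartsWithOnes k l = ∀ j → j < k → nth l j ≡ 1

KConnected-build⁻ : ∀ k w → KConnected k (build w) → StartsWithOnes k (bList w)
KConnected-build⁻ zero          w               _  j ()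
KConnected-build⁻ (suc k)       []              kc = ⊥-elim (¬KConnected-null kc)
KConnected-build⁻ (suc k)       (opS ∷ w)       kc zero    _         = refl
KConnected-build⁻ (suc k)       (opS ∷ w)       kc (suc j) (s≤s j<k) = KConnected-build⁻ k w (KConnected-S⁻ kc) j j<k
KConnected-build⁻ (suc k)       (opD ∷ [])      kc with KConnected-D⁻ kc
... | _ , refl = λ { zero _ → refl ; (suc j) (s≤s ()) }
KConnected-build⁻ (suc k)       (opD ∷ _ ∷ _)   kc with () ← proj₁ (KConnected-D⁻ kc)

KConnected-build⁺ : ∀ k w → StartsWithOnes k (bList w) → KConnected k (build w)
KConnected-build⁺ zero          w               _    = z≤n , λ _ ()
KConnected-build⁺ (suc k)       []              ones with () ← ones 0 (s≤s z≤n)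
KConnected-build⁺ (suc k)       (opS ∷ w)       ones =
  KConnected-S⁺ (KConnected-build⁺ k w (λ j j<k → ones (suc j) (s≤s j<k)))
KConnected-build⁺ (suc zero)    (opD ∷ [])      _    = KConnected-D-null nullGraph
KConnected-build⁺ (suc (suc k)) (opD ∷ [])      ones with () ← ones 1 (s≤s (s≤s z≤n))
KConnected-build⁺ (suc k)       (opD ∷ opS ∷ w) ones with () ← ones 0 (s≤s z≤n)
KConnected-build⁺ (suc k)       (opD ∷ opD ∷ w) ones with bList w | ones 0 (s≤s z≤n)
... | []    | ()
... | _ ∷ _ | ()

KConnected-build⇔ : ∀ {k} w → KConnected k (build w) ⇔ StartsWithOnes k (bList w)
KConnected-build⇔ {k} w = mk⇔ (KConnected-build⁻ k w) (KConnected-build⁺ k w)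

word : List ℕ → List Op
word []       = []
word (b ∷ bs) = replicateᴸ (pred b) opD ++ opS ∷ word bs

bList-word : ∀ {l} → All (0 <_) l → bList (word l) ≡ l
bList-word []                         = refl
bList-word {suc b ∷ bs} (s≤s _ ∷ ps) = trans (bList-Dⁿ b) (cong (suc b ∷_) (bList-word ps))
  where
  bList-Dⁿ : ∀ m → bList (replicateᴸ m opD ++ opS ∷ word bs) ≡ suc m ∷ bList (word bs)
  bList-Dⁿ zero    = refl
  bList-Dⁿ (suc m) = cong incHead (bList-Dⁿ m)

-- Substituting x - 1

-- consXm1 c p lists the coefficients of c + (x - 1)·p, so substXm1ᴸ is Horner's scheme.
consXm1 : ℤ → List ℤ → List ℤ
consXm1 c []       = c ∷ []
consXm1 c (p ∷ ps) = (c - p) ∷ consXm1 p ps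

substXm1ᴸ : List ℤ → List ℤ
substXm1ᴸ []       = []
substXm1ᴸ (c ∷ cs) = consXm1 c (substXm1ᴸ cs)

toList-substXm1 : (v : Vec ℤ n) → toList (substXm1 v) ≡ substXm1ᴸ (toList v)
toList-substXm1 []       = refl
toList-substXm1 (c ∷ cs) =
  trans (toList-addConst-mulXm1 (substXm1 cs)) (cong (consXm1 c) (toList-substXm1 cs))
  where
  toList-shift : ∀ {m} y (u : Vec ℤ m) → toList (zipWith _-_ (y ∷ u) (u ∷ʳ + 0)) ≡ consXm1 y (toList u)
  toList-shift y []       = cong (_∷ []) (ℤₚ.+-identityʳ y)
  toList-shift y (x ∷ xs) = cong ((y - x) ∷_) (toList-shift x xs)
  toList-addConst-mulXm1 : ∀ {m} (u : Vec ℤ m) → toList (addConst c (mulXm1 u)) ≡ consXm1 c (toList u)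
  toList-addConst-mulXm1 []       = cong (_∷ []) (ℤₚ.+-identityʳ c)
  toList-addConst-mulXm1 (x ∷ xs) = cong₂ _∷_ (cong (λ z → c ℤ.+ z) (ℤₚ.+-identityˡ (- x))) (toList-shift x xs)

toList-bVec : (c : Vec ℕ n) → toList (bVec c) ≡ substXm1ᴸ (map +_ (toList c))
toList-bVec c = trans (toList-substXm1 (Vec.map +_ c)) (cong substXm1ᴸ (toList-map +_ c))

consXm1≢[] : ∀ c p → consXm1 c p ≢ []
consXm1≢[] c []      ()
consXm1≢[] c (_ ∷ _) ()

consXm1-injective : ∀ {c c' p p'} → consXm1 c p ≡ consXm1 c' p' → c ≡ c' × p ≡ p'
consXm1-injective {p = []}     {[]}      refl = refl , refl
consXm1-injective {p = []}     {x' ∷ p'} e    = ⊥-elim (consXm1≢[] x' p' (sym (∷-injectiveʳ e)))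
consXm1-injective {p = x ∷ p}  {[]}      e    = ⊥-elim (consXm1≢[] x p (∷-injectiveʳ e))
consXm1-injective {c} {c'} {x ∷ p} {x' ∷ p'} e with consXm1-injective (∷-injectiveʳ e)
... | refl , refl = -‿cancelʳ (∷-injectiveˡ e) , refl
  where
  -‿cancelʳ : c - x ≡ c' - x → c ≡ c'
  -‿cancelʳ e' = trans (sym (minus-plus c x)) (trans (cong (λ z → z ℤ.+ x) e') (minus-plus c' x))
    where
    minus-plus : ∀ i j → i - j ℤ.+ j ≡ i
    minus-plus = solve-∀

substXm1ᴸ-injective : ∀ {p q} → substXm1ᴸ p ≡ substXm1ᴸ q → p ≡ q
substXm1ᴸ-injective {[]}     {[]}     _ = refl
substXm1ᴸ-injective {[]}     {c ∷ cs} e = ⊥-elim (consXm1≢[] c (substXm1ᴸ cs) (sym e))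
substXm1ᴸ-injective {c ∷ cs} {[]}     e = ⊥-elim (consXm1≢[] c (substXm1ᴸ cs) e)
substXm1ᴸ-injective {c ∷ cs} {d ∷ ds} e with consXm1-injective e
... | refl , e' = cong (c ∷_) (substXm1ᴸ-injective e')

substXm1ᴸ-mulOnePlusX : ∀ a l → substXm1ᴸ (map +_ (mulOnePlusX a l)) ≡ + a ∷ substXm1ᴸ (map +_ l)
substXm1ᴸ-mulOnePlusX a []       = refl
substXm1ᴸ-mulOnePlusX a (x ∷ xs) =
  trans (cong (consXm1 (+ (x + a))) (substXm1ᴸ-mulOnePlusX x xs))
        (cong (_∷ consXm1 (+ x) (substXm1ᴸ (map +_ xs))) (trans (cong (_- + x) (ℤₚ.pos-+ x a)) (cancel (+ x) (+ a))))
  where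
  cancel : ∀ i j → i ℤ.+ j - i ≡ j
  cancel = solve-∀

substXm1ᴸ-incHead : ∀ l b → substXm1ᴸ (map +_ l) ≡ map +_ b → substXm1ᴸ (map +_ (incHead l)) ≡ map +_ (incHead b)
substXm1ᴸ-incHead []       []      _ = refl
substXm1ᴸ-incHead (x ∷ xs) b       e with substXm1ᴸ (map +_ xs)
substXm1ᴸ-incHead (x ∷ xs) (y ∷ []) refl | [] = refl
substXm1ᴸ-incHead (x ∷ xs) (y ∷ ys) e    | p ∷ ps = cong₂ _∷_ head (∷-injectiveʳ e)
  where
  head : + suc x - p ≡ + suc y
  head = begin
    + suc x - p         ≡⟨ cong (_- p) (ℤₚ.pos-+ 1 x) ⟩
    + 1 ℤ.+ + x - p     ≡⟨ ℤₚ.+-assoc (+ 1) (+ x) (- p) ⟩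
    + 1 ℤ.+ (+ x - p)   ≡⟨ cong (λ z → + 1 ℤ.+ z) (∷-injectiveˡ e) ⟩
    + 1 ℤ.+ + y         ≡⟨ sym (ℤₚ.pos-+ 1 y) ⟩
    + suc y             ∎
    where open ≡-Reasoning

substXm1ᴸ-cliqueList : ∀ w → substXm1ᴸ (map +_ (cliqueList w)) ≡ map +_ (bList w)
substXm1ᴸ-cliqueList []        = refl
substXm1ᴸ-cliqueList (opS ∷ w) =
  trans (substXm1ᴸ-mulOnePlusX 1 (cliqueList w)) (cong (+ 1 ∷_) (substXm1ᴸ-cliqueList w))
substXm1ᴸ-cliqueList (opD ∷ w) = substXm1ᴸ-incHead (cliqueList w) (bList w) (substXm1ᴸ-cliqueList w)

lookup≡nth : ∀ {d} (c : Vec ℕ d) (i : Fin d) → lookup c i ≡ nth (toList c) (toℕ i)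
lookup≡nth (x ∷ c) zero    = refl
lookup≡nth (x ∷ c) (suc i) = lookup≡nth c i

toList-≡ : ∀ {d} (c : Vec ℕ d) (l : List ℕ) → d ≡ length l → (∀ i → lookup c i ≡ nth l (toℕ i)) → toList c ≡ l
toList-≡ []      []      _ _ = refl
toList-≡ (x ∷ c) (y ∷ l) e h = cong₂ _∷_ (h zero) (toList-≡ c l (cong pred e) (h ∘ suc))

IsCliqueVector-build : ∀ w {d} (c : Vec ℕ d) → IsCliqueVector (build w) c ⇔ toList c ≡ cliqueList w
IsCliqueVector-build w c = mk⇔
  (λ (d≡ω , counts) → toList-≡ c (cliqueList w) (trans d≡ω (cliqueNumber-build w))
    (λ i → trans (counts i) (numCliques-build w (suc (toℕ i)))))
  (λ c≡ → trans (sym (length-toList c)) (trans (cong length c≡) (sym (cliqueNumber-build w))) ,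
    λ i → trans (lookup≡nth c i) (trans (cong (λ l → nth l (toℕ i)) c≡) (sym (numCliques-build w (suc (toℕ i))))))

cliqueList⇔bList : ∀ w {d} (c : Vec ℕ d) → toList c ≡ cliqueList w ⇔ toList (bVec c) ≡ map +_ (bList w)
cliqueList⇔bList w c = mk⇔
  (λ c≡ → trans (toList-bVec c) (trans (cong (λ l → substXm1ᴸ (map +_ l)) c≡) (substXm1ᴸ-cliqueList w)))
  (λ b≡ → map-injective ℤₚ.+-injective (substXm1ᴸ-injective
    (trans (sym (toList-bVec c)) (trans b≡ (sym (substXm1ᴸ-cliqueList w))))))

IsCliqueVector-build⇔bVec : ∀ w {d} (c : Vec ℕ d) →
  IsCliqueVector (build w) c ⇔ toList (bVec c) ≡ map +_ (bList w)
IsCliqueVector-build⇔bVec w c = cliqueList⇔bList w c ⇔-∘ IsCliqueVector-build w c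

coeff≡nth : ∀ {d} (v : Vec ℤ d) {l} → toList v ≡ map +_ l → ∀ j → coeff v j ≡ + nth l j
coeff≡nth []      {[]}    _ _       = refl
coeff≡nth (x ∷ v) {y ∷ l} e zero    = ∷-injectiveˡ e
coeff≡nth (x ∷ v) {y ∷ l} e (suc j) = coeff≡nth v (∷-injectiveʳ e) j

lookup-positive : ∀ {d} (v : Vec ℤ d) {l} → toList v ≡ map +_ l → All (0 <_) l → ∀ i → + 0 ℤ.< lookup v i
lookup-positive (x ∷ v) {y ∷ l} e (0<y ∷ _)  zero    = subst (+ 0 ℤ.<_) (sym (∷-injectiveˡ e)) (+<+ 0<y)
lookup-positive (x ∷ v) {y ∷ l} e (_ ∷ 0<l) (suc i) = lookup-positive v (∷-injectiveʳ e) 0<l i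

positive⇒natural : ∀ {d} (v : Vec ℤ d) → (∀ i → + 0 ℤ.< lookup v i) →
  Σ (List ℕ) λ l → toList v ≡ map +_ l × All (0 <_) l
positive⇒natural []      _   = [] , refl , []
positive⇒natural (x ∷ v) pos with positive⇒natural v (pos ∘ suc) | pos zero
... | l , e , 0<l | +<+ {n = y} 0<y = y ∷ l , cong (+ y ∷_) e , 0<y ∷ 0<l

corollary2p3 : (k d : ℕ) → 1 ≤ d → (c : Vec ℕ d) →
    (Σ ℕ λ n → Σ (Graph n) λ G → IsThreshold G × KConnected k G × IsCliqueVector G c)
    ⇔ ((∀ (i : Fin d) → + 0 Data.Integer.< lookup (bVec c) i)
       × (∀ (j : ℕ) → j < k → coeff (bVec c) j ≡ + 1))
corollary2p3 k d _ c = mk⇔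
  (λ (n , G , (w , G≅w) , kc , cv) →
    let b≡ = to (IsCliqueVector-build⇔bVec w c) (IsCliqueVector-iso {G = G} {H = build w} G≅w {c = c} cv)
    in lookup-positive (bVec c) b≡ (bList-positive w) ,
       λ j j<k → trans (coeff≡nth (bVec c) b≡ j)
                       (cong +_ (to (KConnected-build⇔ w) (KConnected-iso G≅w kc) j j<k)))
  (λ (pos , ones) →
    let (l , b≡l , 0<l) = positive⇒natural (bVec c) pos
        w = word l
        b≡ = trans b≡l (cong (λ l → map +_ l) (sym (bList-word 0<l)))
    in length w , build w , (w , ↔-id _ , λ _ _ → refl) ,
       from (KConnected-build⇔ w) (λ j j<k → ℤₚ.+-injective (trans (sym (coeff≡nth (bVec c) b≡ j)) (ones j j<k))) ,
       from (IsCliqueVector-build⇔bVec w c) b≡)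
  where open Equivalence
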